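{- Let $n\ge 1$ be an integer and let $A\subseteq\mathbb{Z}_5^n$ be sum-free with $|A|>\frac32\cdot5^{n-1}$. Then for every maximal proper subgroup $H<\mathbb{Z}_5^n$, it is not the case that $A$ has non-empty intersection with exactly three $H$-cosets.
   Context: $\mathbb{Z}_5^n$ denotes the elementary abelian $5$-group of rank $n$. A subset $S$ of an abelian group is sum-free if there are no $x,y,z\in S$ (not necessarily distinct) with $x+y=z$. -}

module Defs where

open import Data.Nat using (ℕ; _+_; _∸_)
open import Data.Nat.DivMod using (_mod_)
open import Data.Fin using (Fin; toℕ; zero)
open import Data.Vec using (Vec; zipWith; map; replicate)
open import Data.List using (List)
open import Data.List.Membership.Propositional using (_∈_)
open import Data.Product using (_×_; ∃)
open import Data.Sum using (_⊎_)
open import Relation.Nullary using (¬_)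
open import Relation.Binary.PropositionalEquality using (_≢_)

Z5^ : ℕ → Set
Z5^ n = Vec (Fin 5) n

_+₅_ : Fin 5 → Fin 5 → Fin 5
a +₅ b = (toℕ a + toℕ b) mod 5

-₅_ : Fin 5 → Fin 5
-₅ a = (5 ∸ toℕ a) mod 5

_⊕_ : ∀ {n} → Z5^ n → Z5^ n → Z5^ n
_⊕_ = zipWith _+₅_

⊖_ : ∀ {n} → Z5^ n → Z5^ n
⊖_ = map -₅_

𝟘 : ∀ {n} → Z5^ n
𝟘 = replicate _ zero

Pred : ℕ → Set₁
Pred n = Z5^ n → Set

IsSubgroup : ∀ {n} → Pred n → Set
IsSubgroup {n} H =
  H 𝟘 × (∀ x y → H x → H y → H (x ⊕ y)) × (∀ x → H x → H (⊖ x))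

IsMaximalProperSubgroup : ∀ {n} → Pred n → Set₁
IsMaximalProperSubgroup {n} H =
  IsSubgroup H
  × ∃ (λ x → ¬ H x)
  × (∀ (K : Pred n) → IsSubgroup K → (∀ x → H x → K x) →
       (∀ x → K x → H x) ⊎ (∀ x → K x))

SameCoset : ∀ {n} → Pred n → Z5^ n → Z5^ n → Set
SameCoset H x y = H (x ⊕ (⊖ y))

-- finite subsets of Z_5^n are duplicate-free lists; |A| = length A
SumFree : ∀ {n} → List (Z5^ n) → Set
SumFree A = ∀ x y z → x ∈ A → y ∈ A → z ∈ A → x ⊕ y ≢ z

MeetsExactlyThreeCosets : ∀ {n} → Pred n → List (Z5^ n) → Set
MeetsExactlyThreeCosets H A =
  ∃ λ a₁ → ∃ λ a₂ → ∃ λ a₃ →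
    a₁ ∈ A × a₂ ∈ A × a₃ ∈ A
    × ¬ SameCoset H a₁ a₂ × ¬ SameCoset H a₁ a₃ × ¬ SameCoset H a₂ a₃
    × (∀ a → a ∈ A → SameCoset H a a₁ ⊎ SameCoset H a a₂ ⊎ SameCoset H a a₃)

-- Since H is maximal and 5 is prime, any g ∉ H gives Z₅ⁿ⁺¹ = H ⊕ ⟨g⟩, so the H-cosets are the
-- fibres of a homomorphism ℓ : Z₅ⁿ⁺¹ → ℤ₅ (the ⟨g⟩-coordinate), each of size 5ⁿ. Write
-- A_u = A ∩ ℓ⁻¹(u). If c ∈ A has ℓ c = u + v, then x ↦ c − x maps A_u injectively into ℓ⁻¹(v)
-- and, A being sum-free, misses A_v; hence |A_u| + |A_v| ≤ 5ⁿ. Any three distinct residues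
-- p, q, r modulo 5 can be ordered so that p + q and 2r both lie in {p, q, r}. So if A met only
-- the cosets p, q, r, then 2|A| ≤ 2(|A_p| + |A_q|) + (|A_r| + |A_r|) ≤ 3 · 5ⁿ.
module Submission where

open import Defs
open import Data.Nat using (ℕ; suc; _*_; _^_; _>_)
open import Data.List using (List; length)
open import Data.List.Relation.Unary.Unique.Propositional using (Unique)
open import Relation.Nullary using (¬_)

open import Level using (Level; 0ℓ)
open import Algebra.Bundles using (AbelianGroup)
open import Algebra.Core using (Op₁; Op₂)
open import Algebra.Definitions
  using (Associative; Commutative; LeftIdentity; LeftInverse; _DistributesOverʳ_)
open import Algebra.Structures using (IsAbelianGroup)
open import Algebra.Consequences.Propositional using (comm∧idˡ⇒id; comm∧invˡ⇒inv)
import Algebra.Properties.AbelianGroup as AbelianGroupProperties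
import Algebra.Properties.CommutativeSemigroup as CommutativeSemigroupProperties
open import Data.Empty using (⊥-elim)
open import Function using (_∘_)
open import Data.Fin using (Fin; zero; suc; toℕ; _≟_)
open import Data.Fin.Properties using (all?; any?)
open import Data.List using ([]; _∷_; _++_; map; filter; allFin; cartesianProduct; cartesianProductWith)
open import Data.List.Properties using (length-++; length-map; length-++-sucʳ)
open import Data.List.Membership.Propositional using (_∈_)
open import Data.List.Membership.Propositional.Properties
  using (∈-∃++; ∈-++⁺ˡ; ∈-++⁺ʳ; ∈-++⁻; ∈-map⁻; ∈-filter⁺; ∈-filter⁻;
         ∈-cartesianProduct⁻; ∈-cartesianProductWith⁺; ∈-allFin)
open import Data.List.Membership.DecPropositional {A = Fin 5} _≟_ using (_∈?_)
open import Data.List.Relation.Binary.Subset.Propositional using (_⊆_)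
open import Data.List.Relation.Binary.Disjoint.Propositional using (Disjoint)
open import Data.List.Relation.Unary.Any using (here; there)
import Data.List.Relation.Unary.All as All
import Data.List.Relation.Unary.All.Properties as All
open import Data.List.Relation.Unary.AllPairs using ([]; _∷_)
import Data.List.Relation.Unary.Unique.Propositional.Properties as Unique
import Data.Nat.Properties as ℕ
open import Data.Nat using (zero; _+_; _≤_; z≤n; s≤s)
open import Data.Nat.DivMod using (_mod_)
open import Data.Nat.Tactic.RingSolver using (solve-∀)
open import Data.Product using (∃; ∃₂; _×_; _,_; proj₁; proj₂)
open import Data.Sum using (inj₁; inj₂; _⊎_)
open import Data.Vec using (Vec; []; _∷_; zipWith)
  renaming (map to vmap)
open import Data.Vec.Properties
  using (zipWith-assoc; zipWith-comm; zipWith-identityˡ; zipWith-inverseˡ;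
         map-cong; map-∘; map-id; map-const; ∷-injective)
open import Relation.Binary.PropositionalEquality
open import Relation.Nullary using (Dec; yes; no)
open import Relation.Nullary.Decidable using (toWitness; ¬?; _→-dec_; _×-dec_; _⊎-dec_)

private
  variable
    a b c : Level
    A : Set a
    B : Set b
    C : Set c

≡-isAbelianGroup : {_∙_ : Op₂ A} {ε : A} {_⁻¹ : Op₁ A} →
  Associative _≡_ _∙_ → LeftIdentity _≡_ ε _∙_ → LeftInverse _≡_ ε _⁻¹ _∙_ →
  Commutative _≡_ _∙_ → IsAbelianGroup _≡_ _∙_ ε _⁻¹
≡-isAbelianGroup {_∙_ = _∙_} {_⁻¹ = _⁻¹} assoc identityˡ inverseˡ comm = record
  { isGroup = record
    { isMonoid = record
      { isSemigroup = record
        { isMagma = record { isEquivalence = isEquivalence ; ∙-cong = cong₂ _∙_ }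
        ; assoc = assoc
        }
      ; identity = comm∧idˡ⇒id comm identityˡ
      }
    ; inverse = comm∧invˡ⇒inv comm inverseˡ
    ; ⁻¹-cong = cong _⁻¹
    }
  ; comm = comm
  }

Unique∧⊆⇒length≤ : {xs ys : List A} → Unique xs → xs ⊆ ys → length xs ≤ length ys
Unique∧⊆⇒length≤ {xs = []} _ _ = z≤n
Unique∧⊆⇒length≤ {xs = x ∷ xs} (x∉xs ∷ xs-unique) x∷xs⊆ys
  with ys₁ , ys₂ , refl ← ∈-∃++ (x∷xs⊆ys (here refl)) =
  subst (suc (length xs) ≤_) (sym (length-++-sucʳ ys₁ x ys₂))
    (s≤s (Unique∧⊆⇒length≤ xs-unique xs⊆ys₁++ys₂))
  where
  xs⊆ys₁++ys₂ : xs ⊆ ys₁ ++ ys₂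
  xs⊆ys₁++ys₂ {y} y∈xs with ∈-++⁻ ys₁ (x∷xs⊆ys (there y∈xs))
  ... | inj₁ y∈ys₁         = ∈-++⁺ˡ y∈ys₁
  ... | inj₂ (here y≡x)    = ⊥-elim (All.lookup x∉xs y∈xs (sym y≡x))
  ... | inj₂ (there y∈ys₂) = ∈-++⁺ʳ ys₁ y∈ys₂

Unique-map⁺ : ∀ {f : A → B} {xs} → (∀ {x y} → x ∈ xs → y ∈ xs → f x ≡ f y → x ≡ y) →
  Unique xs → Unique (map f xs)
Unique-map⁺ {xs = []} _ [] = []
Unique-map⁺ {xs = x ∷ xs} inj (x∉xs ∷ xs-unique) =
  All.map⁺ (All.tabulate λ y∈xs fx≡fy → All.lookup x∉xs y∈xs (inj (here refl) (there y∈xs) fx≡fy))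
  ∷ Unique-map⁺ (λ x∈xs y∈xs → inj (there x∈xs) (there y∈xs)) xs-unique

length-cartesianProductWith : ∀ (f : A → B → C) xs ys →
  length (cartesianProductWith f xs ys) ≡ length xs * length ys
length-cartesianProductWith f []       ys = refl
length-cartesianProductWith f (x ∷ xs) ys = begin
  length (map (f x) ys ++ cartesianProductWith f xs ys)  ≡⟨ length-++ (map (f x) ys) ⟩
  length (map (f x) ys) + length (cartesianProductWith f xs ys)
    ≡⟨ cong₂ _+_ (length-map (f x) ys) (length-cartesianProductWith f xs ys) ⟩
  length ys + length xs * length ys                      ∎
  where open ≡-Reasoning

vectors : List A → ∀ m → List (Vec A m)
vectors xs zero    = [] ∷ []
vectors xs (suc m) = cartesianProductWith _∷_ xs (vectors xs m)

length-vectors : ∀ (xs : List A) m → length (vectors xs m) ≡ length xs ^ m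
length-vectors xs zero    = refl
length-vectors xs (suc m) =
  trans (length-cartesianProductWith _∷_ xs (vectors xs m)) (cong (length xs *_) (length-vectors xs m))

∈-vectors : ∀ {xs : List A} → (∀ a → a ∈ xs) → ∀ {m} (v : Vec A m) → v ∈ vectors xs m
∈-vectors complete []      = here refl
∈-vectors complete (a ∷ v) = ∈-cartesianProductWith⁺ _∷_ (complete a) (∈-vectors complete v)

Unique-vectors : ∀ {xs : List A} → Unique xs → ∀ m → Unique (vectors xs m)
Unique-vectors xs-unique zero    = All.[] ∷ []
Unique-vectors xs-unique (suc m) =
  Unique.cartesianProductWith⁺ _∷_ ∷-injective xs-unique (Unique-vectors xs-unique m)

_*₅_ : Fin 5 → Fin 5 → Fin 5
a *₅ b = (toℕ a * toℕ b) mod 5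

1₅ : Fin 5
1₅ = suc zero

-- ℤ₅ is finite: the identities below are decided by evaluation at every point.

+₅-assoc : Associative _≡_ _+₅_
+₅-assoc = toWitness {a? = all? λ a → all? λ b → all? λ c → (a +₅ b) +₅ c ≟ a +₅ (b +₅ c)} _

+₅-comm : Commutative _≡_ _+₅_
+₅-comm = toWitness {a? = all? λ a → all? λ b → a +₅ b ≟ b +₅ a} _

+₅-identityˡ : LeftIdentity _≡_ zero _+₅_
+₅-identityˡ = toWitness {a? = all? λ a → zero +₅ a ≟ a} _

-₅-inverseˡ : LeftInverse _≡_ zero -₅_ _+₅_
-₅-inverseˡ = toWitness {a? = all? λ a → (-₅ a) +₅ a ≟ zero} _

*₅-distribʳ-+₅ : _DistributesOverʳ_ _≡_ _*₅_ _+₅_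
*₅-distribʳ-+₅ =
  toWitness {a? = all? λ a → all? λ b → all? λ c → (b +₅ c) *₅ a ≟ (b *₅ a) +₅ (c *₅ a)} _

*₅-assoc : Associative _≡_ _*₅_
*₅-assoc = toWitness {a? = all? λ a → all? λ b → all? λ c → (a *₅ b) *₅ c ≟ a *₅ (b *₅ c)} _

*₅-identityˡ : LeftIdentity _≡_ 1₅ _*₅_
*₅-identityˡ = toWitness {a? = all? λ a → 1₅ *₅ a ≟ a} _

*₅-inverseˡ : ∀ t → t ≢ zero → ∃ λ s → s *₅ t ≡ 1₅
*₅-inverseˡ = toWitness {a? = all? λ t → ¬? (t ≟ zero) →-dec any? λ s → s *₅ t ≟ 1₅} _

fromℕ₅ : ℕ → Fin 5
fromℕ₅ zero    = zero
fromℕ₅ (suc k) = fromℕ₅ k +₅ 1₅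

fromℕ₅-toℕ : ∀ t → fromℕ₅ (toℕ t) ≡ t
fromℕ₅-toℕ = toWitness {a? = all? λ t → fromℕ₅ (toℕ t) ≟ t} _

ℤ₅-abelianGroup : AbelianGroup 0ℓ 0ℓ
ℤ₅-abelianGroup = record
  { Carrier = Fin 5 ; _≈_ = _≡_ ; _∙_ = _+₅_ ; ε = zero ; _⁻¹ = -₅_
  ; isAbelianGroup = ≡-isAbelianGroup +₅-assoc +₅-identityˡ -₅-inverseˡ +₅-comm
  }

module ℤ₅ where
  open AbelianGroup ℤ₅-abelianGroup public
  open AbelianGroupProperties ℤ₅-abelianGroup public

SumAndDouble : Fin 5 → Fin 5 → Fin 5 → Set
SumAndDouble p q r = (p +₅ q ∈ pqr × r +₅ r ∈ pqr)
                   ⊎ (q +₅ r ∈ pqr × p +₅ p ∈ pqr)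
                   ⊎ (p +₅ r ∈ pqr × q +₅ q ∈ pqr)
  where pqr = p ∷ q ∷ r ∷ []

sumAndDouble? : ∀ p q r → Dec (SumAndDouble p q r)
sumAndDouble? p q r = (p +₅ q ∈? pqr ×-dec r +₅ r ∈? pqr)
               ⊎-dec (q +₅ r ∈? pqr ×-dec p +₅ p ∈? pqr)
               ⊎-dec (p +₅ r ∈? pqr ×-dec q +₅ q ∈? pqr)
  where pqr = p ∷ q ∷ r ∷ []

distinct⇒sumAndDouble : ∀ p q r → p ≢ q → p ≢ r → q ≢ r → SumAndDouble p q r
distinct⇒sumAndDouble = toWitness {a? = all? λ p → all? λ q → all? λ r →
  ¬? (p ≟ q) →-dec ¬? (p ≟ r) →-dec ¬? (q ≟ r) →-dec sumAndDouble? p q r} _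

pair+double≤ : ∀ x y z {N} → x + y ≤ N → z + z ≤ N → 2 * (x + (y + z)) ≤ 3 * N
pair+double≤ x y z {N} x+y≤N z+z≤N = begin
  2 * (x + (y + z))              ≡⟨ regroup x y z ⟩
  (x + y) + ((x + y) + (z + z))  ≤⟨ ℕ.+-mono-≤ x+y≤N (ℕ.+-mono-≤ x+y≤N z+z≤N) ⟩
  N + (N + N)                    ≡⟨ triple N ⟩
  3 * N                          ∎
  where
  open ℕ.≤-Reasoning
  regroup : ∀ x y z → 2 * (x + (y + z)) ≡ (x + y) + ((x + y) + (z + z))
  regroup = solve-∀
  triple : ∀ N → N + (N + N) ≡ 3 * N
  triple = solve-∀

sumAndDouble-bound : ∀ (a : Fin 5 → ℕ) {N p q r} → SumAndDouble p q r →
  (∀ u v → u +₅ v ∈ p ∷ q ∷ r ∷ [] → a u + a v ≤ N) → 2 * (a p + (a q + a r)) ≤ 3 * N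
sumAndDouble-bound a {N} {p} {q} {r} (inj₁ (p+q∈ , r+r∈)) pair≤ =
  pair+double≤ (a p) (a q) (a r) (pair≤ p q p+q∈) (pair≤ r r r+r∈)
sumAndDouble-bound a {N} {p} {q} {r} (inj₂ (inj₁ (q+r∈ , p+p∈))) pair≤ =
  subst (λ s → 2 * s ≤ 3 * N) (sym (x∙yz≈y∙zx (a p) (a q) (a r)))
    (pair+double≤ (a q) (a r) (a p) (pair≤ q r q+r∈) (pair≤ p p p+p∈))
  where open CommutativeSemigroupProperties ℕ.+-commutativeSemigroup using (x∙yz≈y∙zx)
sumAndDouble-bound a {N} {p} {q} {r} (inj₂ (inj₂ (p+r∈ , q+q∈))) pair≤ =
  subst (λ s → 2 * (a p + s) ≤ 3 * N) (ℕ.+-comm (a r) (a q))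
    (pair+double≤ (a p) (a r) (a q) (pair≤ p r p+r∈) (pair≤ q q q+q∈))

Z5ⁿ-abelianGroup : ℕ → AbelianGroup 0ℓ 0ℓ
Z5ⁿ-abelianGroup m = record
  { Carrier = Z5^ m ; _≈_ = _≡_ ; _∙_ = _⊕_ ; ε = 𝟘 ; _⁻¹ = ⊖_
  ; isAbelianGroup = ≡-isAbelianGroup (zipWith-assoc +₅-assoc) (zipWith-identityˡ +₅-identityˡ)
                                      (zipWith-inverseˡ -₅-inverseˡ) (zipWith-comm +₅-comm)
  }

module Z5ⁿ {m : ℕ} where
  open AbelianGroup (Z5ⁿ-abelianGroup m) public
  open AbelianGroupProperties (Z5ⁿ-abelianGroup m) public
  open CommutativeSemigroupProperties commutativeSemigroup public using (interchange)

infixr 25 _·_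
_·_ : ∀ {m} → Fin 5 → Z5^ m → Z5^ m
t · x = vmap (t *₅_) x

zipWith-map-map : ∀ {n} (f : B → C → A) (g : A → B) (h : A → C) (xs : Vec A n) →
  zipWith f (vmap g xs) (vmap h xs) ≡ vmap (λ x → f (g x) (h x)) xs
zipWith-map-map f g h []       = refl
zipWith-map-map f g h (x ∷ xs) = cong (_ ∷_) (zipWith-map-map f g h xs)

module _ {m : ℕ} where

  ·-distribʳ : ∀ t s (x : Z5^ m) → t · x ⊕ s · x ≡ (t +₅ s) · x
  ·-distribʳ t s x =
    trans (zipWith-map-map _+₅_ _ _ x) (sym (map-cong (λ a → *₅-distribʳ-+₅ a t s) x))

  ·-zeroˡ : ∀ (x : Z5^ m) → zero · x ≡ 𝟘
  ·-zeroˡ x = map-const x zero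

  ·-identityˡ : ∀ (x : Z5^ m) → 1₅ · x ≡ x
  ·-identityˡ x = trans (map-cong *₅-identityˡ x) (map-id x)

  ·-assoc : ∀ s t (x : Z5^ m) → s · t · x ≡ (s *₅ t) · x
  ·-assoc s t x = trans (sym (map-∘ _ _ x)) (map-cong (λ a → sym (*₅-assoc s t a)) x)

  ·-⊖ : ∀ t (x : Z5^ m) → (-₅ t) · x ≡ ⊖ (t · x)
  ·-⊖ t x = Z5ⁿ.inverseʳ-unique (t · x) _ (begin
    t · x ⊕ (-₅ t) · x  ≡⟨ ·-distribʳ t (-₅ t) x ⟩
    (t +₅ (-₅ t)) · x   ≡⟨ cong (_· x) (ℤ₅.inverseʳ t) ⟩
    zero · x            ≡⟨ ·-zeroˡ x ⟩
    𝟘                   ∎)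
    where open ≡-Reasoning

  ⊕-zero· : ∀ (x y : Z5^ m) → x ⊕ zero · y ≡ x
  ⊕-zero· x y = trans (cong (x ⊕_) (·-zeroˡ y)) (Z5ⁿ.identityʳ x)

module Subgroup {m} {H : Pred m} (H-subgroup : IsSubgroup H) where

  H-𝟘 : H 𝟘
  H-𝟘 = proj₁ H-subgroup

  H-⊕ : ∀ {x y} → H x → H y → H (x ⊕ y)
  H-⊕ = proj₁ (proj₂ H-subgroup) _ _

  H-⊖ : ∀ {x} → H x → H (⊖ x)
  H-⊖ = proj₂ (proj₂ H-subgroup) _

  ·-closed : ∀ t {x} → H x → H (t · x)
  ·-closed t {x} x∈H = subst (λ s → H (s · x)) (fromℕ₅-toℕ t) (multiples (toℕ t))
    where
    multiples : ∀ k → H (fromℕ₅ k · x)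
    multiples zero    = subst H (sym (·-zeroˡ x)) H-𝟘
    multiples (suc k) = subst H (·-distribʳ (fromℕ₅ k) 1₅ x)
                          (H-⊕ (multiples k) (subst H (sym (·-identityˡ x)) x∈H))

_+⟨_⟩ : ∀ {m} → Pred m → Z5^ m → Pred m
(H +⟨ g ⟩) x = ∃₂ λ h t → H h × x ≡ h ⊕ t · g

module _ {m} {g : Z5^ m} where

  ⊕-collect : ∀ h h' t s → (h ⊕ t · g) ⊕ (h' ⊕ s · g) ≡ (h ⊕ h') ⊕ (t +₅ s) · g
  ⊕-collect h h' t s =
    trans (Z5ⁿ.interchange h (t · g) h' (s · g)) (cong ((h ⊕ h') ⊕_) (·-distribʳ t s g))

  ⊖-collect : ∀ h t → ⊖ (h ⊕ t · g) ≡ (⊖ h) ⊕ (-₅ t) · g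
  ⊖-collect h t = trans (sym (Z5ⁿ.⁻¹-∙-comm h (t · g))) (cong ((⊖ h) ⊕_) (sym (·-⊖ t g)))

  module _ {H : Pred m} (H-subgroup : IsSubgroup H) where
    open Subgroup H-subgroup

    +⟨⟩-isSubgroup : IsSubgroup (H +⟨ g ⟩)
    +⟨⟩-isSubgroup =
        (𝟘 , zero , H-𝟘 , sym (⊕-zero· 𝟘 g))
      , (λ { _ _ (h , t , h∈H , refl) (h' , s , h'∈H , refl) →
               h ⊕ h' , t +₅ s , H-⊕ h∈H h'∈H , ⊕-collect h h' t s })
      , (λ { _ (h , t , h∈H , refl) → ⊖ h , -₅ t , H-⊖ h∈H , ⊖-collect h t })

    maximal⇒+⟨⟩-total : ¬ H g →
      (∀ (K : Pred m) → IsSubgroup K → (∀ x → H x → K x) → (∀ x → K x → H x) ⊎ (∀ x → K x)) →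
      ∀ x → (H +⟨ g ⟩) x
    maximal⇒+⟨⟩-total g∉H maximal
      with maximal (H +⟨ g ⟩) +⟨⟩-isSubgroup (λ x x∈H → x , zero , x∈H , sym (⊕-zero· x g))
    ... | inj₁ H+⟨g⟩⊆H = ⊥-elim (g∉H (H+⟨g⟩⊆H g (𝟘 , 1₅ , H-𝟘 , g≡𝟘⊕1·g)))
      where
      g≡𝟘⊕1·g : g ≡ 𝟘 ⊕ 1₅ · g
      g≡𝟘⊕1·g = sym (trans (Z5ⁿ.identityˡ (1₅ · g)) (·-identityˡ g))
    ... | inj₂ total = total

-- The label of an element: its ⟨g⟩-coordinate modulo H

module Label {m} {H : Pred m} (H-subgroup : IsSubgroup H) {g : Z5^ m} (g∉H : ¬ H g)
             (spanned : ∀ x → (H +⟨ g ⟩) x) where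
  open Subgroup H-subgroup

  ·g∈H⇒≡zero : ∀ t → H (t · g) → t ≡ zero
  ·g∈H⇒≡zero t t·g∈H with t ≟ zero
  ... | yes t≡0 = t≡0
  ... | no t≢0 with s , s*t≡1 ← *₅-inverseˡ t t≢0 =
    ⊥-elim (g∉H (subst H s·t·g≡g (·-closed s t·g∈H)))
    where
    s·t·g≡g : s · t · g ≡ g
    s·t·g≡g = trans (·-assoc s t g) (trans (cong (_· g) s*t≡1) (·-identityˡ g))

  coordinate-unique : ∀ {h h' t s} → H h → H h' → h ⊕ t · g ≡ h' ⊕ s · g → t ≡ s
  coordinate-unique {h} {h'} {t} {s} h∈H h'∈H eq =
    ℤ₅.x∙y⁻¹≈ε⇒x≈y t s (·g∈H⇒≡zero _ (subst H (sym difference) (H-⊕ (H-⊖ h∈H) h'∈H)))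
    where
    difference : (t +₅ (-₅ s)) · g ≡ (⊖ h) ⊕ h'
    difference = begin
      (t +₅ (-₅ s)) · g                      ≡⟨ ·-distribʳ t (-₅ s) g ⟨
      t · g ⊕ (-₅ s) · g                     ≡⟨ cong₂ _⊕_ (Z5ⁿ.\\-leftDividesʳ h (t · g)) (sym (·-⊖ s g)) ⟨
      ((⊖ h) ⊕ (h ⊕ t · g)) ⊕ (⊖ (s · g))    ≡⟨ cong (λ y → ((⊖ h) ⊕ y) ⊕ (⊖ (s · g))) eq ⟩
      ((⊖ h) ⊕ (h' ⊕ s · g)) ⊕ (⊖ (s · g))   ≡⟨ Z5ⁿ.assoc (⊖ h) _ _ ⟩
      (⊖ h) ⊕ ((h' ⊕ s · g) ⊕ (⊖ (s · g)))   ≡⟨ cong ((⊖ h) ⊕_) (Z5ⁿ.//-rightDividesʳ (s · g) h') ⟩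
      (⊖ h) ⊕ h'                             ∎
      where open ≡-Reasoning

  label : Z5^ m → Fin 5
  label x = proj₁ (proj₂ (spanned x))

  label-unique : ∀ {x h t} → H h → x ≡ h ⊕ t · g → label x ≡ t
  label-unique {x} h∈H x≡h⊕t·g =
    let (h₀ , _ , h₀∈H , x≡h₀⊕ℓx·g) = spanned x
    in coordinate-unique h₀∈H h∈H (trans (sym x≡h₀⊕ℓx·g) x≡h⊕t·g)

  label-⊕ : ∀ x y → label (x ⊕ y) ≡ label x +₅ label y
  label-⊕ x y =
    let (hx , tx , hx∈H , x≡) = spanned x
        (hy , ty , hy∈H , y≡) = spanned y
    in label-unique (H-⊕ hx∈H hy∈H) (trans (cong₂ _⊕_ x≡ y≡) (⊕-collect hx hy tx ty))

  label-·g : ∀ t → label (t · g) ≡ t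
  label-·g t = label-unique H-𝟘 (sym (Z5ⁿ.identityˡ (t · g)))

  H⇒label≡zero : ∀ {x} → H x → label x ≡ zero
  H⇒label≡zero {x} x∈H = label-unique x∈H (sym (⊕-zero· x g))

  label≡zero⇒H : ∀ {x} → label x ≡ zero → H x
  label≡zero⇒H {x} ℓx≡0 =
    let (h , t , h∈H , x≡h⊕t·g) = spanned x
    in subst H (sym (trans x≡h⊕t·g (trans (cong (λ s → h ⊕ s · g) ℓx≡0) (⊕-zero· h g)))) h∈H

  label-⊖ : ∀ x → label (⊖ x) ≡ -₅ label x
  label-⊖ x = ℤ₅.inverseʳ-unique (label x) (label (⊖ x)) (begin
    label x +₅ label (⊖ x)  ≡⟨ label-⊕ x (⊖ x) ⟨
    label (x ⊕ (⊖ x))       ≡⟨ H⇒label≡zero (subst H (sym (Z5ⁿ.inverseʳ x)) H-𝟘) ⟩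
    zero                    ∎)
    where open ≡-Reasoning

  label-− : ∀ x y → label (x ⊕ (⊖ y)) ≡ label x +₅ (-₅ label y)
  label-− x y = trans (label-⊕ x (⊖ y)) (cong (label x +₅_) (label-⊖ y))

  sameCoset⇒label≡ : ∀ {x y} → SameCoset H x y → label x ≡ label y
  sameCoset⇒label≡ {x} {y} x−y∈H =
    ℤ₅.x∙y⁻¹≈ε⇒x≈y _ _ (trans (sym (label-− x y)) (H⇒label≡zero x−y∈H))

  label≡⇒sameCoset : ∀ {x y} → label x ≡ label y → SameCoset H x y
  label≡⇒sameCoset {x} {y} ℓx≡ℓy = label≡zero⇒H (trans (label-− x y) (ℤ₅.x≈y⇒x∙y⁻¹≈ε ℓx≡ℓy))

  label-reflect : ∀ {c x u v} → label c ≡ u +₅ v → label x ≡ u → label (c ⊕ (⊖ x)) ≡ v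
  label-reflect {c} {x} {u} {v} ℓc≡u+v ℓx≡u = begin
    label (c ⊕ (⊖ x))        ≡⟨ label-− c x ⟩
    label c +₅ (-₅ label x)  ≡⟨ cong₂ (λ a b → a +₅ (-₅ b)) ℓc≡u+v ℓx≡u ⟩
    (u +₅ v) +₅ (-₅ u)       ≡⟨ ℤ₅.xyx⁻¹≈y u v ⟩
    v                        ∎
    where open ≡-Reasoning

  sameCoset⇒label∈ : ∀ {x a₁ a₂ a₃} → SameCoset H x a₁ ⊎ SameCoset H x a₂ ⊎ SameCoset H x a₃ →
    label x ∈ map label (a₁ ∷ a₂ ∷ a₃ ∷ [])
  sameCoset⇒label∈ (inj₁ x~a₁)        = here (sameCoset⇒label≡ x~a₁)
  sameCoset⇒label∈ (inj₂ (inj₁ x~a₂)) = there (here (sameCoset⇒label≡ x~a₂))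
  sameCoset⇒label∈ (inj₂ (inj₂ x~a₃)) = there (there (here (sameCoset⇒label≡ x~a₃)))

  label-shift : ∀ x t → label (x ⊕ t · g) ≡ label x +₅ t
  label-shift x t = trans (label-⊕ x (t · g)) (cong (label x +₅_) (label-·g t))

  withLabel : Fin 5 → List (Z5^ m) → List (Z5^ m)
  withLabel v = filter (λ x → label x ≟ v)

  fibre : Fin 5 → List (Z5^ m)
  fibre v = withLabel v (vectors (allFin 5) m)

  ∈-withLabel : ∀ {x v xs} → x ∈ xs → label x ≡ v → x ∈ withLabel v xs
  ∈-withLabel {v = v} = ∈-filter⁺ (λ x → label x ≟ v)

  ∈-withLabel⁻ : ∀ {x v} xs → x ∈ withLabel v xs → x ∈ xs × label x ≡ v
  ∈-withLabel⁻ {v = v} xs = ∈-filter⁻ (λ x → label x ≟ v) {xs = xs}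

  ∈-fibre : ∀ {x v} → label x ≡ v → x ∈ fibre v
  ∈-fibre = ∈-withLabel (∈-vectors ∈-allFin _)

  Unique-fibre : ∀ v → Unique (fibre v)
  Unique-fibre v = Unique.filter⁺ (λ x → label x ≟ v) (Unique-vectors (Unique.allFin⁺ 5) m)

  translate-injective : ∀ {v t s x y} → label x ≡ v → label y ≡ v → x ⊕ t · g ≡ y ⊕ s · g →
    (t , x) ≡ (s , y)
  translate-injective {v} {t} {s} {x} {y} ℓx≡v ℓy≡v x⊕t·g≡y⊕s·g =
    cong₂ _,_ t≡s (Z5ⁿ.∙-cancelʳ (t · g) x y (trans x⊕t·g≡y⊕s·g (cong (λ r → y ⊕ r · g) (sym t≡s))))
    where
    open ≡-Reasoning
    t≡s : t ≡ s
    t≡s = ℤ₅.∙-cancelˡ v t s (begin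
      v +₅ t             ≡⟨ cong (_+₅ t) ℓx≡v ⟨
      label x +₅ t       ≡⟨ label-shift x t ⟨
      label (x ⊕ t · g)  ≡⟨ cong label x⊕t·g≡y⊕s·g ⟩
      label (y ⊕ s · g)  ≡⟨ label-shift y s ⟩
      label y +₅ s       ≡⟨ cong (_+₅ s) ℓy≡v ⟩
      v +₅ s             ∎)

  fibre-bound : ∀ v → 5 * length (fibre v) ≤ 5 ^ m
  fibre-bound v = begin
    5 * length (fibre v)           ≡⟨ length-cartesianProductWith _,_ (allFin 5) (fibre v) ⟨
    length pairs                   ≡⟨ length-map translate pairs ⟨
    length (map translate pairs)   ≤⟨ Unique∧⊆⇒length≤ translates-unique (λ _ → ∈-vectors ∈-allFin _) ⟩
    length (vectors (allFin 5) m)  ≡⟨ length-vectors (allFin 5) m ⟩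
    5 ^ m                          ∎
    where
    open ℕ.≤-Reasoning
    pairs : List (Fin 5 × Z5^ m)
    pairs = cartesianProduct (allFin 5) (fibre v)

    translate : Fin 5 × Z5^ m → Z5^ m
    translate (t , x) = x ⊕ t · g

    label≡v : ∀ {t x} → (t , x) ∈ pairs → label x ≡ v
    label≡v tx∈pairs =
      let (_ , x∈fibre) = ∈-cartesianProduct⁻ (allFin 5) (fibre v) tx∈pairs
      in proj₂ (∈-withLabel⁻ (vectors (allFin 5) m) x∈fibre)

    translates-unique : Unique (map translate pairs)
    translates-unique =
      Unique-map⁺ (λ p∈pairs q∈pairs → translate-injective (label≡v p∈pairs) (label≡v q∈pairs))
                  (Unique.cartesianProduct⁺ (Unique.allFin⁺ 5) (Unique-fibre v))

  sumFree-bound : ∀ {A c u v} → Unique A → SumFree A → c ∈ A → label c ≡ u +₅ v →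
    length (withLabel u A) + length (withLabel v A) ≤ length (fibre v)
  sumFree-bound {A} {c} {u} {v} A-unique A-sumFree c∈A ℓc≡u+v = begin
    length (withLabel u A) + length (withLabel v A)  ≡⟨ cong (_+ _) (length-map reflect (withLabel u A)) ⟨
    length reflected + length (withLabel v A)        ≡⟨ length-++ reflected ⟨
    length (reflected ++ withLabel v A)              ≤⟨ Unique∧⊆⇒length≤ unique ⊆fibre ⟩
    length (fibre v)                                 ∎
    where
    open ℕ.≤-Reasoning
    reflect : Z5^ m → Z5^ m
    reflect x = c ⊕ (⊖ x)

    reflected : List (Z5^ m)
    reflected = map reflect (withLabel u A)

    disjoint : Disjoint reflected (withLabel v A)
    disjoint (y∈reflected , y∈Av) with x , x∈Au , refl ← ∈-map⁻ reflect y∈reflected =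
      A-sumFree x (reflect x) c (proj₁ (∈-withLabel⁻ A x∈Au)) (proj₁ (∈-withLabel⁻ A y∈Av)) c∈A
        (trans (Z5ⁿ.comm x (reflect x)) (Z5ⁿ.//-rightDividesˡ x c))

    unique : Unique (reflected ++ withLabel v A)
    unique = Unique.++⁺ (Unique.map⁺ (λ eq → Z5ⁿ.⁻¹-injective (Z5ⁿ.∙-cancelˡ c _ _ eq))
                                     (Unique.filter⁺ (λ x → label x ≟ u) A-unique))
                        (Unique.filter⁺ (λ x → label x ≟ v) A-unique) disjoint

    ⊆fibre : reflected ++ withLabel v A ⊆ fibre v
    ⊆fibre y∈ with ∈-++⁻ reflected y∈
    ... | inj₂ y∈Av = ∈-fibre (proj₂ (∈-withLabel⁻ A y∈Av))
    ... | inj₁ y∈reflected with x , x∈Au , refl ← ∈-map⁻ reflect y∈reflected =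
      ∈-fibre (label-reflect ℓc≡u+v (proj₂ (∈-withLabel⁻ A x∈Au)))

  length≤withLabels : ∀ {xs p q r} → Unique xs → (∀ {x} → x ∈ xs → label x ∈ p ∷ q ∷ r ∷ []) →
    length xs ≤ length (withLabel p xs) + (length (withLabel q xs) + length (withLabel r xs))
  length≤withLabels {xs} {p} {q} {r} xs-unique labels∈pqr = begin
    length xs                            ≤⟨ Unique∧⊆⇒length≤ xs-unique xs⊆Ap++Aq++Ar ⟩
    length (Ap ++ Aq ++ Ar)              ≡⟨ length-++ Ap ⟩
    length Ap + length (Aq ++ Ar)        ≡⟨ cong (length Ap +_) (length-++ Aq) ⟩
    length Ap + (length Aq + length Ar)  ∎
    where
    open ℕ.≤-Reasoning
    Ap = withLabel p xs
    Aq = withLabel q xs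
    Ar = withLabel r xs
    xs⊆Ap++Aq++Ar : xs ⊆ Ap ++ Aq ++ Ar
    xs⊆Ap++Aq++Ar x∈xs with labels∈pqr x∈xs
    ... | here ℓx≡p                 = ∈-++⁺ˡ (∈-withLabel x∈xs ℓx≡p)
    ... | there (here ℓx≡q)         = ∈-++⁺ʳ Ap (∈-++⁺ˡ (∈-withLabel x∈xs ℓx≡q))
    ... | there (there (here ℓx≡r)) = ∈-++⁺ʳ Ap (∈-++⁺ʳ Aq (∈-withLabel x∈xs ℓx≡r))

proposition1 : (n : ℕ) → (A : List (Z5^ (suc n))) → Unique A → SumFree A
    → 2 * length A > 3 * 5 ^ n
    → (H : Pred (suc n)) → IsMaximalProperSubgroup H
    → ¬ MeetsExactlyThreeCosets H A
proposition1 n A A-unique A-sumFree A-large H (H-subgroup , (g , g∉H) , H-maximal)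
             (a₁ , a₂ , a₃ , a₁∈A , a₂∈A , a₃∈A , a₁≁a₂ , a₁≁a₃ , a₂≁a₃ , A-covered) =
  ℕ.<⇒≱ A-large (begin
    2 * length A                         ≤⟨ ℕ.*-monoʳ-≤ 2 (length≤withLabels A-unique label∈pqr) ⟩
    2 * (count p + (count q + count r))  ≤⟨ sumAndDouble-bound count pqr-sumAndDouble pair-bound ⟩
    3 * 5 ^ n                            ∎)
  where
  open Label H-subgroup g∉H (maximal⇒+⟨⟩-total H-subgroup g∉H H-maximal)
  open ℕ.≤-Reasoning

  representatives : List (Z5^ (suc n))
  representatives = a₁ ∷ a₂ ∷ a₃ ∷ []

  p q r : Fin 5
  p = label a₁
  q = label a₂
  r = label a₃

  count : Fin 5 → ℕ
  count v = length (withLabel v A)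

  pqr-sumAndDouble : SumAndDouble p q r
  pqr-sumAndDouble = distinct⇒sumAndDouble p q r
    (a₁≁a₂ ∘ label≡⇒sameCoset) (a₁≁a₃ ∘ label≡⇒sameCoset) (a₂≁a₃ ∘ label≡⇒sameCoset)

  label∈pqr : ∀ {x} → x ∈ A → label x ∈ p ∷ q ∷ r ∷ []
  label∈pqr x∈A = sameCoset⇒label∈ (A-covered _ x∈A)

  representatives⊆A : representatives ⊆ A
  representatives⊆A (here refl)                 = a₁∈A
  representatives⊆A (there (here refl))         = a₂∈A
  representatives⊆A (there (there (here refl))) = a₃∈A

  pair-bound : ∀ u v → u +₅ v ∈ p ∷ q ∷ r ∷ [] → count u + count v ≤ 5 ^ n
  pair-bound u v u+v∈pqr with c , c∈A₃ , u+v≡ℓc ← ∈-map⁻ label {xs = representatives} u+v∈pqr =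
    ℕ.*-cancelˡ-≤ 5 (ℕ.≤-trans
      (ℕ.*-monoʳ-≤ 5 (sumFree-bound A-unique A-sumFree (representatives⊆A c∈A₃) (sym u+v≡ℓc)))
      (fibre-bound v))
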